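{- For all $k,r\in\mathbb{N}$, every graph $G$ with $\operatorname{cw}_r(G)\le k$ satisfies $\operatorname{fw}_r(G)\le \pi_G(k)+k$.
   Context: All graphs are finite, simple and undirected; $\mathbb{N}=\{1,2,\dots\}$; $N_G(v)$ is the neighbourhood of $v$. For $S\subseteq V(G)$ let $\pi_G(S)=|\{N_G(v)\cap S : v\in V(G)\setminus S\}|$, and for $k\in\mathbb{N}$ let $\pi_G(k)=\max\{\pi_G(S): S\subseteq V(G), |S|\le k\}$. Cop-width game with radius $r$ and width $k$ on $G$: initially the cops occupy a set $C_0\subseteq V(G)$ with $|C_0|\le k$ and the robber chooses a vertex $x_0$. In each round $i\ge1$, the cops announce a new set $C_i\subseteq V(G)$ with $|C_i|\le k$; the robber, knowing $C_i$, moves from $x_{i-1}$ to a vertex $x_i$ along a path in $G$ of length at most $r$ containing no vertex of $C_{i-1}\cap C_i$. The robber is caught if $x_i\in C_i$. $\operatorname{cw}_r(G)$ is the least $k\in\mathbb{N}$ such that the cops can guarantee capture in finitely many rounds. Flips: for $A,B\subseteq V(G)$, flipping between $A$ and $B$ inverts the adjacency of every pair $a,b$ with $a\in A$, $b\in B$. For a partition $\mathcal{P}$ of $V(G)$, a $\mathcal{P}$-flip of $G$ is a graph obtained from $G$ by a sequence of flips between pairs of parts $A,B\in\mathcal{P}$ (possibly $A=B$); a $k$-flip is a $\mathcal{P}$-flip for some partition with $|\mathcal{P}|\le k$. Flip-width game with radius $r$ and width $k$ on $G$: $G_0=G$ and the runner chooses a vertex $x_0$. In each round $i\ge1$ the flipper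 announces a $k$-flip $G_i$ of $G$; the runner, knowing $G_i$, moves from $x_{i-1}$ to a vertex $x_i$ along a path of length at most $r$ in $G_{i-1}$. The game ends (flipper wins) when $x_i$ is isolated in $G_i$. $\operatorname{fw}_r(G)$ is the least $k\in\mathbb{N}$ such that the flipper can guarantee the game ends after finitely many rounds. -}

module Defs where

open import Data.Bool using (Bool; true; false; _∧_; _∨_; _xor_; not)
import Data.Bool.Properties as BoolP
open import Data.Nat using (ℕ; zero; suc; _≤_; _≤?_; _⊔_; _+_)
open import Data.Fin using (Fin; _≟_)
open import Data.Fin.Subset using (Subset; _∈_; _∉_; _∩_; ∣_∣)
open import Data.Fin.Subset.Properties using (_∈?_)
open import Data.Vec using (Vec; []; _∷_; tabulate; lookup)
import Data.Vec.Properties as VecP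
open import Data.List using (List; []; _∷_; map; filter; length; foldr; allFin; deduplicate; _++_)
open import Data.Product using (Σ; _×_; _,_; ∃)
open import Data.Sum using (_⊎_)
open import Data.Unit using (⊤)
open import Relation.Nullary using (¬_; ¬?)
open import Relation.Nullary.Decidable using (⌊_⌋)
open import Relation.Binary.PropositionalEquality using (_≡_; _≢_)

record Graph (n : ℕ) : Set where
  field
    adj   : Fin n → Fin n → Bool
    sym   : ∀ u v → adj u v ≡ adj v u
    irref : ∀ u → adj u u ≡ false
open Graph public

Adj : ℕ → Set
Adj n = Fin n → Fin n → Bool

Edge : ∀ {n} → Adj n → Fin n → Fin n → Set
Edge H u v = (u ≢ v) × (H u v ≡ true)

-- Walks of length at most r from x to y in H, all of whose vertices
-- satisfy the predicate ok.  (A walk of length ≤ r exists iff a path of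
-- length ≤ r exists.)
data WalkLe {n : ℕ} (H : Adj n) (ok : Fin n → Set) : ℕ → Fin n → Fin n → Set where
  here  : ∀ {r x} → ok x → WalkLe H ok r x x
  there : ∀ {r x y z} → ok x → Edge H x y → WalkLe H ok r y z → WalkLe H ok (suc r) x z

trace : ∀ {n} → Graph n → Subset n → Fin n → Subset n
trace G S v = tabulate (λ u → adj G v u ∧ lookup S u)

πS : ∀ {n} → Graph n → Subset n → ℕ
πS G S = length (deduplicate (VecP.≡-dec BoolP._≟_)
                   (map (trace G S) (filter (λ v → ¬? (v ∈? S)) (allFin _))))

allSubsets : (n : ℕ) → List (Subset n)
allSubsets zero    = [] ∷ []
allSubsets (suc n) = map (true ∷_) (allSubsets n) ++ map (false ∷_) (allSubsets n)

πk : ∀ {n} → Graph n → ℕ → ℕ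
πk {n} G k = foldr _⊔_ 0 (map (πS G) (filter (λ S → ∣ S ∣ ≤? k) (allSubsets n)))

RobberMove : ∀ {n} → Graph n → ℕ → Subset n → Fin n → Fin n → Set
RobberMove G r X x y = WalkLe (adj G) (λ v → v ∉ X) r x y

data CopsWin {n : ℕ} (G : Graph n) (r k : ℕ) : Subset n → Fin n → Set where
  caught : ∀ {C x} → x ∈ C → CopsWin G r k C x
  step   : ∀ {C x} (C' : Subset n) → ∣ C' ∣ ≤ k →
           (∀ y → RobberMove G r (C ∩ C') x y → CopsWin G r k C' y) →
           CopsWin G r k C x

CopsWinGame : ∀ {n} → Graph n → (r k : ℕ) → Set
CopsWinGame {n} G r k = Σ (Subset n) λ C₀ → (∣ C₀ ∣ ≤ k) × (∀ x₀ → CopsWin G r k C₀ x₀)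

-- cw_r(G) ≤ k  (cw_r(G) is the least k' ∈ {1,2,…} for which cops win)
CwLe : ∀ {n} → Graph n → (r k : ℕ) → Set
CwLe G r k = ∃ λ k' → (1 ≤ k') × (k' ≤ k) × CopsWinGame G r k'

flipAB : ∀ {n} → Subset n → Subset n → Adj n → Adj n
flipAB A B H u v =
  H u v xor (not ⌊ u ≟ v ⌋ ∧ ((lookup A u ∧ lookup B v) ∨ (lookup B u ∧ lookup A v)))

part : ∀ {n k} → (Fin n → Fin k) → Fin k → Subset n
part p i = tabulate (λ v → ⌊ p v ≟ i ⌋)

flips : ∀ {n k} → (Fin n → Fin k) → List (Fin k × Fin k) → Adj n → Adj n
flips p []             H = H
flips p ((i , j) ∷ fs) H = flipAB (part p i) (part p j) (flips p fs H)

record KFlip {n : ℕ} (k : ℕ) : Set where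
  constructor kflip
  field
    partition : Fin n → Fin k
    flipSeq   : List (Fin k × Fin k)

apply : ∀ {n k} → Graph n → KFlip {n} k → Adj n
apply G (kflip p fs) = flips p fs (adj G)

Isolated : ∀ {n} → Adj n → Fin n → Set
Isolated H x = ∀ y → ¬ Edge H x y

data FlipperWins {n : ℕ} (G : Graph n) (r k : ℕ) : Adj n → Fin n → Set where
  step : ∀ {H x} (F : KFlip {n} k) →
         (∀ y → WalkLe H (λ _ → ⊤) r x y →
                Isolated (apply G F) y ⊎ FlipperWins G r k (apply G F) y) →
         FlipperWins G r k H x

FlipperWinsGame : ∀ {n} → Graph n → (r k : ℕ) → Set
FlipperWinsGame G r k = ∀ x₀ → FlipperWins G r k (adj G) x₀

FwLe : ∀ {n} → Graph n → (r m : ℕ) → Set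
FwLe G r m = ∃ λ m' → (1 ≤ m') × (m' ≤ m) × FlipperWinsGame G r m'

-- When the cops stand on C, partition V(G) into the singletons of C and, outside C, the
-- classes of equal trace N(v) ∩ C; there are at most π_G(k) + k parts.  Every edge meeting C
-- then joins two parts that are completely adjacent, so flipping those pairs of parts
-- isolates C and leaves G − C untouched.  A runner moving in this flip of G is therefore a
-- robber avoiding C, and the flipper, announcing the flip for the cops' next position each
-- round, wins by following the cops' winning strategy.
module Submission where

open import Defs hiding (sym)
open import Data.Bool using (Bool; true; false; _∧_; _∨_; _xor_)
open import Data.Bool.Properties
  using (xor-assoc; xor-comm; xor-same; xor-identityʳ; ∧-comm; ∧-zeroʳ; ∧-identityʳ; ∨-comm; ∨-identityʳ)
  renaming (_≟_ to _≟ᵇ_)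
open import Data.Nat using (ℕ; zero; suc; _≤_; _≤?_; _⊔_; _+_; s≤s)
open import Data.Nat.Properties using (≤-trans; ≤-refl; ≤-reflexive; m≤n+m; m≤m⊔n; m≤n⊔m; +-mono-≤)
open import Data.Fin using (Fin; zero; suc; inject≤) renaming (_≤_ to _≤ᶠ_)
open import Data.Fin.Properties using (_≟_; any?; inject≤-injective; ≤-total)
open import Data.Fin.Subset using (Subset; _∈_; _∉_; _∩_; ∣_∣)
open import Data.Fin.Subset.Properties using (_∈?_; x∈p∩q⁻)
open import Data.Vec using ([]; _∷_; lookup)
open import Data.Vec.Properties using (lookup∘tabulate; []=⇒lookup; ≡-dec)
import Data.Vec as Vec
open import Data.List using (List; []; _∷_; map; filter; length; foldr; allFin; deduplicate; _++_)
open import Data.List.Properties using (length-map; length-++)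
open import Data.List.Membership.Propositional using () renaming (_∈_ to _∈ₗ_)
open import Data.List.Membership.Propositional.Properties
  using (∈-map⁺; ∈-++⁺ˡ; ∈-++⁺ʳ; ∈-filter⁺; ∈-deduplicate⁺; ∈-allFin)
open import Data.List.Relation.Unary.Any using (here; there; index)
open import Data.List.Relation.Unary.Any.Properties using (lookup-index)
import Data.Product as Prod
open import Data.Product using (_×_; _,_; ∃₂; proj₁; proj₂)
open import Data.Sum using (_⊎_; inj₁; inj₂)
open import Data.Unit using (⊤)
open import Relation.Nullary using (Dec; yes; no; does; ¬?; _×-dec_; contradiction)
open import Relation.Nullary.Decidable using (⌊_⌋; isYes≗does; dec-true; dec-false)
open import Relation.Binary.PropositionalEquality

toggles : ∀ {m} → Fin m → Fin m → Fin m → Fin m → Bool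
toggles i j a b = (does (a ≟ i) ∧ does (b ≟ j)) ∨ (does (a ≟ j) ∧ does (b ≟ i))

parity : ∀ {m} → List (Fin m × Fin m) → Fin m → Fin m → Bool
parity []             a b = false
parity ((i , j) ∷ fs) a b = toggles i j a b xor parity fs a b

lookup-part : ∀ {n m} (p : Fin n → Fin m) i u → lookup (part p i) u ≡ does (p u ≟ i)
lookup-part p i u = trans (lookup∘tabulate (λ w → ⌊ p w ≟ i ⌋) u) (isYes≗does (p u ≟ i))

flipAB-part : ∀ {n m} (p : Fin n → Fin m) i j (H : Adj n) {u v} → u ≢ v →
              flipAB (part p i) (part p j) H u v ≡ H u v xor toggles i j (p u) (p v)
flipAB-part p i j H {u} {v} u≢v
  rewrite isYes≗does (u ≟ v) | dec-false (u ≟ v) u≢v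
        | lookup-part p i u | lookup-part p j v | lookup-part p j u | lookup-part p i v = refl

flips-xor : ∀ {n m} (p : Fin n → Fin m) fs (H : Adj n) {u v} → u ≢ v →
            flips p fs H u v ≡ H u v xor parity fs (p u) (p v)
flips-xor p []             H u≢v = sym (xor-identityʳ _)
flips-xor p ((i , j) ∷ fs) H {u} {v} u≢v = begin
  flipAB (part p i) (part p j) (flips p fs H) u v
    ≡⟨ flipAB-part p i j (flips p fs H) u≢v ⟩
  flips p fs H u v xor toggles i j (p u) (p v)
    ≡⟨ cong (_xor toggles i j (p u) (p v)) (flips-xor p fs H u≢v) ⟩
  (H u v xor parity fs (p u) (p v)) xor toggles i j (p u) (p v)
    ≡⟨ xor-assoc (H u v) _ _ ⟩
  H u v xor (parity fs (p u) (p v) xor toggles i j (p u) (p v))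
    ≡⟨ cong (H u v xor_) (xor-comm (parity fs (p u) (p v)) _) ⟩
  H u v xor parity ((i , j) ∷ fs) (p u) (p v) ∎
  where open ≡-Reasoning

toggles-sym : ∀ {m} (i j a b : Fin m) → toggles i j a b ≡ toggles i j b a
toggles-sym i j a b =
  trans (∨-comm (does (a ≟ i) ∧ does (b ≟ j)) _) (cong₂ _∨_ (∧-comm (does (a ≟ j)) _) (∧-comm (does (a ≟ i)) _))

parity-sym : ∀ {m} fs (a b : Fin m) → parity fs a b ≡ parity fs b a
parity-sym []             a b = refl
parity-sym ((i , j) ∷ fs) a b = cong₂ _xor_ (toggles-sym i j a b) (parity-sym fs a b)

parity-++ : ∀ {m} (xs ys : List (Fin m × Fin m)) a b →
            parity (xs ++ ys) a b ≡ parity xs a b xor parity ys a b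
parity-++ []             ys a b = refl
parity-++ ((i , j) ∷ xs) ys a b =
  trans (cong (toggles i j a b xor_) (parity-++ xs ys a b)) (sym (xor-assoc (toggles i j a b) _ _))

support : ∀ {m} → (Fin m → Bool) → List (Fin m)
support {zero}  w = []
support {suc m} w with w zero
... | true  = zero ∷ map suc (support (λ j → w (suc j)))
... | false = map suc (support (λ j → w (suc j)))

occurs₂ : ∀ {m} → List (Fin m) → Fin m → Bool
occurs₂ []       b = false
occurs₂ (j ∷ js) b = does (b ≟ j) xor occurs₂ js b

occurs₂-map-suc-zero : ∀ {m} (js : List (Fin m)) → occurs₂ (map suc js) zero ≡ false
occurs₂-map-suc-zero []       = refl
occurs₂-map-suc-zero (j ∷ js) = occurs₂-map-suc-zero js

occurs₂-map-suc : ∀ {m} (js : List (Fin m)) b → occurs₂ (map suc js) (suc b) ≡ occurs₂ js b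
occurs₂-map-suc []       b = refl
occurs₂-map-suc (j ∷ js) b = cong (does (b ≟ j) xor_) (occurs₂-map-suc js b)

occurs₂-support : ∀ {m} (w : Fin m → Bool) b → occurs₂ (support w) b ≡ w b
occurs₂-support {suc m} w zero with w zero
... | true  = cong (true xor_) (occurs₂-map-suc-zero (support (λ j → w (suc j))))
... | false = occurs₂-map-suc-zero (support (λ j → w (suc j)))
occurs₂-support {suc m} w (suc b) with w zero
... | true  = trans (occurs₂-map-suc (support (λ j → w (suc j))) b) (occurs₂-support (λ j → w (suc j)) b)
... | false = trans (occurs₂-map-suc (support (λ j → w (suc j))) b) (occurs₂-support (λ j → w (suc j)) b)

firstRow : ∀ {m} → (Fin (suc m) → Bool) → List (Fin (suc m) × Fin (suc m))
firstRow w₀ = map (zero ,_) (support w₀)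

shift : ∀ {m} → List (Fin m × Fin m) → List (Fin (suc m) × Fin (suc m))
shift = map (Prod.map suc suc)

minor : ∀ {m} → (Fin (suc m) → Fin (suc m) → Bool) → Fin m → Fin m → Bool
minor w i j = w (suc i) (suc j)

-- One flip for every pair of parts i ≤ j with w i j.
upper : ∀ {m} → (Fin m → Fin m → Bool) → List (Fin m × Fin m)
upper {zero}  w = []
upper {suc m} w = firstRow (w zero) ++ shift (upper (minor w))

toggles-zero-zero : ∀ {m} (j b : Fin (suc m)) → toggles zero j zero b ≡ does (b ≟ j)
toggles-zero-zero zero    zero    = refl
toggles-zero-zero zero    (suc b) = refl
toggles-zero-zero (suc j) zero    = refl
toggles-zero-zero (suc j) (suc b) = ∨-identityʳ _

parity-row-zero : ∀ {m} (js : List (Fin (suc m))) b → parity (map (zero ,_) js) zero b ≡ occurs₂ js b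
parity-row-zero []       b = refl
parity-row-zero (j ∷ js) b = cong₂ _xor_ (toggles-zero-zero j b) (parity-row-zero js b)

parity-row-suc : ∀ {m} (js : List (Fin (suc m))) a b → parity (map (zero ,_) js) (suc a) (suc b) ≡ false
parity-row-suc []       a b = refl
parity-row-suc (j ∷ js) a b rewrite ∧-zeroʳ (does (suc a ≟ j)) = parity-row-suc js a b

parity-firstRow-zero : ∀ {m} (w₀ : Fin (suc m) → Bool) b → parity (firstRow w₀) zero b ≡ w₀ b
parity-firstRow-zero w₀ b = trans (parity-row-zero (support w₀) b) (occurs₂-support w₀ b)

parity-shift-zero : ∀ {m} (fs : List (Fin m × Fin m)) b → parity (shift fs) zero b ≡ false
parity-shift-zero []             b = refl
parity-shift-zero ((i , j) ∷ fs) b = parity-shift-zero fs b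

parity-shift : ∀ {m} (fs : List (Fin m × Fin m)) a b → parity (shift fs) (suc a) (suc b) ≡ parity fs a b
parity-shift []             a b = refl
parity-shift ((i , j) ∷ fs) a b = cong (toggles i j a b xor_) (parity-shift fs a b)

parity-upper : ∀ {m} (w : Fin m → Fin m → Bool) {a b} → a ≤ᶠ b → parity (upper w) a b ≡ w a b
parity-upper {suc m} w {zero} {b} _ = begin
  parity (firstRow (w zero) ++ shift (upper (minor w))) zero b
    ≡⟨ parity-++ (firstRow (w zero)) _ zero b ⟩
  parity (firstRow (w zero)) zero b xor parity (shift (upper (minor w))) zero b
    ≡⟨ cong₂ _xor_ (parity-firstRow-zero (w zero) b) (parity-shift-zero (upper (minor w)) b) ⟩
  w zero b xor false
    ≡⟨ xor-identityʳ (w zero b) ⟩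
  w zero b ∎
  where open ≡-Reasoning
parity-upper {suc m} w {suc a} {suc b} (s≤s a≤b) = begin
  parity (firstRow (w zero) ++ shift (upper (minor w))) (suc a) (suc b)
    ≡⟨ parity-++ (firstRow (w zero)) _ (suc a) (suc b) ⟩
  parity (firstRow (w zero)) (suc a) (suc b) xor parity (shift (upper (minor w))) (suc a) (suc b)
    ≡⟨ cong₂ _xor_ (parity-row-suc (support (w zero)) a b) (parity-shift (upper (minor w)) a b) ⟩
  parity (upper (minor w)) a b
    ≡⟨ parity-upper (minor w) a≤b ⟩
  w (suc a) (suc b) ∎
  where open ≡-Reasoning

Symmetric : ∀ {n} → Adj n → Set
Symmetric E = ∀ u v → E u v ≡ E v u

Homogeneous : ∀ {n m} → (Fin n → Fin m) → Adj n → Set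
Homogeneous p E = ∀ {u u′ v v′} → p u ≡ p u′ → p v ≡ p v′ → E u v ≡ E u′ v′

flips-upper : ∀ {n m} (p : Fin n → Fin m) (w : Fin m → Fin m → Bool) {E : Adj n} →
              Symmetric E → (∀ u v → w (p u) (p v) ≡ E u v) →
              ∀ H {u v} → u ≢ v → flips p (upper w) H u v ≡ H u v xor E u v
flips-upper p w {E} E-sym w-E H {u} {v} u≢v =
  trans (flips-xor p (upper w) H u≢v) (cong (H u v xor_) (parity≡E (≤-total (p u) (p v))))
  where
  parity≡E : p u ≤ᶠ p v ⊎ p v ≤ᶠ p u → parity (upper w) (p u) (p v) ≡ E u v
  parity≡E (inj₁ pu≤pv) = trans (parity-upper w pu≤pv) (w-E u v)
  parity≡E (inj₂ pv≤pu) =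
    trans (parity-sym (upper w) (p u) (p v)) (trans (parity-upper w pv≤pu) (trans (w-E v u) (E-sym v u)))

Block : ∀ {n m} → (Fin n → Fin m) → Adj n → Fin m → Fin m → Set
Block p E i j = ∃₂ λ u v → p u ≡ i × p v ≡ j × E u v ≡ true

block? : ∀ {n m} (p : Fin n → Fin m) (E : Adj n) i j → Dec (Block p E i j)
block? p E i j = any? λ u → any? λ v → (p u ≟ i) ×-dec (p v ≟ j) ×-dec (E u v ≟ᵇ true)

blocks : ∀ {n m} → (Fin n → Fin m) → Adj n → Fin m → Fin m → Bool
blocks p E i j = does (block? p E i j)

blocks-spec : ∀ {n m} (p : Fin n → Fin m) {E : Adj n} → Homogeneous p E →
              ∀ u v → blocks p E (p u) (p v) ≡ E u v
blocks-spec p {E} hom u v with E u v in Euv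
... | true  = dec-true (block? p E (p u) (p v)) (u , v , refl , refl , Euv)
... | false = dec-false (block? p E (p u) (p v)) λ { (u′ , v′ , pu′ , pv′ , E′) →
                contradiction (trans (sym Euv) (trans (hom (sym pu′) (sym pv′)) E′)) λ () }

homogeneous-flip : ∀ {n m} (p : Fin n → Fin m) {E : Adj n} → Symmetric E → Homogeneous p E →
                   ∀ H {u v} → u ≢ v → flips p (upper (blocks p E)) H u v ≡ H u v xor E u v
homogeneous-flip p E-sym hom = flips-upper p (blocks p _) E-sym (blocks-spec p hom)

classify : ∀ {A : Set} {n m} (f : Fin n → A) (xs : List A) → (∀ v → f v ∈ₗ xs) → length xs ≤ m →
           Fin n → Fin m
classify f xs f∈xs len v = inject≤ (index (f∈xs v)) len

classify-sound : ∀ {A : Set} {n m} (f : Fin n → A) xs f∈xs (len : length xs ≤ m) {u u′} →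
                 classify f xs f∈xs len u ≡ classify f xs f∈xs len u′ → f u ≡ f u′
classify-sound f xs f∈xs len {u} {u′} eq = begin
  f u                                   ≡⟨ lookup-index (f∈xs u) ⟩
  Data.List.lookup xs (index (f∈xs u))  ≡⟨ cong (Data.List.lookup xs) (inject≤-injective len len _ _ eq) ⟩
  Data.List.lookup xs (index (f∈xs u′)) ≡⟨ lookup-index (f∈xs u′) ⟨
  f u′                                  ∎
  where open ≡-Reasoning

elements : ∀ {n} → Subset n → List (Fin n)
elements []          = []
elements (true  ∷ s) = zero ∷ map suc (elements s)
elements (false ∷ s) = map suc (elements s)

length-elements : ∀ {n} (s : Subset n) → length (elements s) ≡ ∣ s ∣
length-elements []          = refl
length-elements (true  ∷ s) = cong suc (trans (length-map suc (elements s)) (length-elements s))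
length-elements (false ∷ s) = trans (length-map suc (elements s)) (length-elements s)

∈-elements : ∀ {n} {s : Subset n} {x} → x ∈ s → x ∈ₗ elements s
∈-elements                  Vec.here        = here refl
∈-elements {s = true  ∷ s} (Vec.there x∈s) = there (∈-map⁺ suc (∈-elements x∈s))
∈-elements {s = false ∷ s} (Vec.there x∈s) = ∈-map⁺ suc (∈-elements x∈s)

≤-foldr-⊔ : ∀ {x} {xs : List ℕ} → x ∈ₗ xs → x ≤ foldr _⊔_ 0 xs
≤-foldr-⊔              (here refl)  = m≤m⊔n _ _
≤-foldr-⊔ {xs = y ∷ _} (there x∈xs) = ≤-trans (≤-foldr-⊔ x∈xs) (m≤n⊔m y _)

∈-allSubsets : ∀ {n} (C : Subset n) → C ∈ₗ allSubsets n
∈-allSubsets         []          = here refl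
∈-allSubsets         (true  ∷ C) = ∈-++⁺ˡ (∈-map⁺ (true ∷_) (∈-allSubsets C))
∈-allSubsets {suc n} (false ∷ C) = ∈-++⁺ʳ (map (true ∷_) (allSubsets n)) (∈-map⁺ (false ∷_) (∈-allSubsets C))

module _ {n} (G : Graph n) where

  πS≤πk : ∀ {k} {C : Subset n} → ∣ C ∣ ≤ k → πS G C ≤ πk G k
  πS≤πk {k} {C} |C|≤k = ≤-foldr-⊔ (∈-map⁺ (πS G) (∈-filter⁺ (λ S → ∣ S ∣ ≤? k) (∈-allSubsets C) |C|≤k))

  traces : Subset n → List (Subset n)
  traces C = deduplicate (≡-dec _≟ᵇ_) (map (trace G C) (filter (λ v → ¬? (v ∈? C)) (allFin n)))

  ∈-traces : ∀ {C v} → v ∉ C → trace G C v ∈ₗ traces C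
  ∈-traces {C} {v} v∉C =
    ∈-deduplicate⁺ (≡-dec _≟ᵇ_) (∈-map⁺ (trace G C) (∈-filter⁺ (λ v → ¬? (v ∈? C)) (∈-allFin v) v∉C))

  lookup-trace : ∀ {C u} v → u ∈ C → lookup (trace G C v) u ≡ adj G v u
  lookup-trace {C} {u} v u∈C = begin
    lookup (trace G C v) u       ≡⟨ lookup∘tabulate (λ w → adj G v w ∧ lookup C w) u ⟩
    adj G v u ∧ lookup C u       ≡⟨ cong (adj G v u ∧_) ([]=⇒lookup u∈C) ⟩
    adj G v u ∧ true             ≡⟨ ∧-identityʳ _ ⟩
    adj G v u                    ∎
    where open ≡-Reasoning

  class : Subset n → Fin n → Subset n ⊎ Fin n
  class C v with v ∈? C
  ... | yes _ = inj₂ v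
  ... | no  _ = inj₁ (trace G C v)

  classes : Subset n → List (Subset n ⊎ Fin n)
  classes C = map inj₁ (traces C) ++ map inj₂ (elements C)

  ∈-classes : ∀ C v → class C v ∈ₗ classes C
  ∈-classes C v with v ∈? C
  ... | yes v∈C = ∈-++⁺ʳ (map inj₁ (traces C)) (∈-map⁺ inj₂ (∈-elements v∈C))
  ... | no  v∉C = ∈-++⁺ˡ (∈-map⁺ inj₁ (∈-traces v∉C))

  length-classes : ∀ C → length (classes C) ≡ πS G C + ∣ C ∣
  length-classes C = begin
    length (classes C)                                    ≡⟨ length-++ (map inj₁ (traces C)) ⟩
    length (map inj₁ (traces C)) + length (map inj₂ (elements C))
      ≡⟨ cong₂ _+_ (length-map inj₁ (traces C)) (trans (length-map inj₂ (elements C)) (length-elements C)) ⟩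
    πS G C + ∣ C ∣                                        ∎
    where open ≡-Reasoning

  cut : Subset n → Adj n
  cut C u v = adj G u v ∧ (does (u ∈? C) ∨ does (v ∈? C))

  cut-sym : ∀ C → Symmetric (cut C)
  cut-sym C u v = cong₂ _∧_ (Graph.sym G u v) (∨-comm (does (u ∈? C)) _)

  cut-meets : ∀ {C u v} → u ∈ C ⊎ v ∈ C → cut C u v ≡ adj G u v
  cut-meets {C} {u} (inj₁ u∈C) rewrite dec-true (u ∈? C) u∈C = ∧-identityʳ _
  cut-meets {C} {u} {v} (inj₂ v∈C) = trans (cut-sym C u v) (trans (cut-meets (inj₁ v∈C)) (Graph.sym G v u))

  cut-outside : ∀ {C u v} → u ∉ C → v ∉ C → cut C u v ≡ false
  cut-outside {C} {u} {v} u∉C v∉C rewrite dec-false (u ∈? C) u∉C | dec-false (v ∈? C) v∉C = ∧-zeroʳ _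

  -- The trace T = N(v) ∩ C of v ∉ C records which c ∈ C are adjacent to v.
  classCut : Subset n ⊎ Fin n → Subset n ⊎ Fin n → Bool
  classCut (inj₂ c) (inj₂ c′) = adj G c c′
  classCut (inj₂ c) (inj₁ T)  = lookup T c
  classCut (inj₁ T) (inj₂ c)  = lookup T c
  classCut (inj₁ _) (inj₁ _)  = false

  cut-class : ∀ C u v → cut C u v ≡ classCut (class C u) (class C v)
  cut-class C u v with u ∈? C | v ∈? C
  ... | yes _   | yes _   = ∧-identityʳ _
  ... | yes u∈C | no  _   = trans (∧-identityʳ _) (trans (Graph.sym G u v) (sym (lookup-trace v u∈C)))
  ... | no  _   | yes v∈C = trans (∧-identityʳ _) (sym (lookup-trace u v∈C))
  ... | no  _   | no  _   = ∧-zeroʳ _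

  cut-homogeneous : ∀ {m} C (p : Fin n → Fin m) → (∀ {u u′} → p u ≡ p u′ → class C u ≡ class C u′) →
                    Homogeneous p (cut C)
  cut-homogeneous C p sound {u} {u′} {v} {v′} pu≡pu′ pv≡pv′ =
    trans (cut-class C u v) (trans (cong₂ classCut (sound pu≡pu′) (sound pv≡pv′)) (sym (cut-class C u′ v′)))

module _ {n} (G : Graph n) (k : ℕ) where

  length-classes≤ : ∀ {C} → ∣ C ∣ ≤ k → length (classes G C) ≤ πk G k + k
  length-classes≤ {C} |C|≤k = ≤-trans (≤-reflexive (length-classes G C)) (+-mono-≤ (πS≤πk G |C|≤k) |C|≤k)

  cutPartition : (C : Subset n) → ∣ C ∣ ≤ k → Fin n → Fin (πk G k + k)
  cutPartition C |C|≤k = classify (class G C) (classes G C) (∈-classes G C) (length-classes≤ |C|≤k)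

  cutFlip : (C : Subset n) → ∣ C ∣ ≤ k → KFlip (πk G k + k)
  cutFlip C |C|≤k = kflip (cutPartition C |C|≤k) (upper (blocks (cutPartition C |C|≤k) (cut G C)))

  flipped : (C : Subset n) → ∣ C ∣ ≤ k → Adj n
  flipped C |C|≤k = apply G (cutFlip C |C|≤k)

  module _ (C : Subset n) (|C|≤k : ∣ C ∣ ≤ k) where

    flipped-adj : ∀ {u v} → u ≢ v → flipped C |C|≤k u v ≡ adj G u v xor cut G C u v
    flipped-adj = homogeneous-flip p (cut-sym G C) (cut-homogeneous G C p same-class) (adj G)
      where
      p : Fin n → Fin (πk G k + k)
      p = cutPartition C |C|≤k
      same-class : ∀ {u u′} → p u ≡ p u′ → class G C u ≡ class G C u′
      same-class = classify-sound (class G C) (classes G C) (∈-classes G C) (length-classes≤ |C|≤k)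

    flipped-removes : ∀ {u v} → u ≢ v → u ∈ C ⊎ v ∈ C → flipped C |C|≤k u v ≡ false
    flipped-removes {u} {v} u≢v meets =
      trans (flipped-adj u≢v) (trans (cong (adj G u v xor_) (cut-meets G meets)) (xor-same (adj G u v)))

    flipped-keeps : ∀ {u v} → u ≢ v → u ∉ C → v ∉ C → flipped C |C|≤k u v ≡ adj G u v
    flipped-keeps {u} {v} u≢v u∉C v∉C =
      trans (flipped-adj u≢v) (trans (cong (adj G u v xor_) (cut-outside G u∉C v∉C)) (xor-identityʳ (adj G u v)))

    flipped-isolates : ∀ {c} → c ∈ C → Isolated (flipped C |C|≤k) c
    flipped-isolates c∈C y (c≢y , edge) = contradiction (trans (sym edge) (flipped-removes c≢y (inj₁ c∈C))) λ ()

    flipped-outside : ∀ {x y} → x ∉ C → Edge (flipped C |C|≤k) x y → y ∉ C × Edge (adj G) x y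
    flipped-outside {x} {y} x∉C (x≢y , edge) with y ∈? C
    ... | yes y∈C = contradiction (trans (sym edge) (flipped-removes x≢y (inj₂ y∈C))) λ ()
    ... | no  y∉C = y∉C , x≢y , trans (sym (flipped-keeps x≢y x∉C y∉C)) edge

walk-transfer : ∀ {n} {H H′ : Adj n} {ok ok′ : Fin n → Set} (Q : Fin n → Set) →
                (∀ {x y} → Q x → Edge H x y → Q y × Edge H′ x y) → (∀ {x} → Q x → ok′ x) →
                ∀ {r x y} → Q x → WalkLe H ok r x y → WalkLe H′ ok′ r x y
walk-transfer Q step-Q Q⇒ok′ Qx (here _)         = here (Q⇒ok′ Qx)
walk-transfer Q step-Q Q⇒ok′ Qx (there _ edge w) =
  there (Q⇒ok′ Qx) (proj₂ (step-Q Qx edge)) (walk-transfer Q step-Q Q⇒ok′ (proj₁ (step-Q Qx edge)) w)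

module _ {n} (G : Graph n) (r k k′ : ℕ) (k′≤k : k′ ≤ k) where

  robber-move : ∀ C (|C|≤k : ∣ C ∣ ≤ k) C′ {x y} → x ∉ C →
                WalkLe (flipped G k C |C|≤k) (λ _ → ⊤) r x y → RobberMove G r (C ∩ C′) x y
  robber-move C |C|≤k C′ = walk-transfer (_∉ C) (flipped-outside G k C |C|≤k)
                                         (λ x∉C x∈C∩C′ → x∉C (proj₁ (x∈p∩q⁻ C C′ x∈C∩C′)))

  mutual
    respond : ∀ C (|C|≤k : ∣ C ∣ ≤ k) y → CopsWin G r k′ C y →
              Isolated (flipped G k C |C|≤k) y ⊎
              FlipperWins G r (πk G k + k) (flipped G k C |C|≤k) y
    respond C |C|≤k y win with y ∈? C
    ... | yes y∈C = inj₁ (flipped-isolates G k C |C|≤k y∈C)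
    ... | no  y∉C = inj₂ (chase |C|≤k y∉C win)

    chase : ∀ {C x} (|C|≤k : ∣ C ∣ ≤ k) → x ∉ C → CopsWin G r k′ C x →
            FlipperWins G r (πk G k + k) (flipped G k C |C|≤k) x
    chase     |C|≤k x∉C (caught x∈C)           = contradiction x∈C x∉C
    chase {C} |C|≤k x∉C (step C′ |C′|≤k′ next) =
      step (cutFlip G k C′ |C′|≤k) λ y walk → respond C′ |C′|≤k y (next y (robber-move C |C|≤k C′ x∉C walk))
      where
      |C′|≤k : ∣ C′ ∣ ≤ k
      |C′|≤k = ≤-trans |C′|≤k′ k′≤k

lemma7 : (k r : ℕ) → 1 ≤ k → 1 ≤ r → (n : ℕ) → (G : Graph n) →
           CwLe G r k → FwLe G r (πk G k + k)
lemma7 k r 1≤k _ n G (k′ , _ , k′≤k , C₀ , |C₀|≤k′ , win) =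
  πk G k + k , ≤-trans 1≤k (m≤n+m k (πk G k)) , ≤-refl ,
  -- The first move is made in G itself, but the cops win against every start of the robber.
  λ x₀ → step (cutFlip G k C₀ |C₀|≤k) λ y _ → respond G r k k′ k′≤k C₀ |C₀|≤k y (win y)
  where
  |C₀|≤k : ∣ C₀ ∣ ≤ k
  |C₀|≤k = ≤-trans |C₀|≤k′ k′≤k
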